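{- For every $m\ge1$, consider the vertex-face walk on the toroidal $(1,m)$-grid, with vertex $(0,j)$ identified with index $j\in\mathbb{Z}_m$. Then for all $t\in\mathbb{Z}_{\ge0}$, \[ B_t=\tfrac12\left(P_m^t+P_m^{ -t}\right), \] where $P_m$ is the $m\times m$ cyclic permutation matrix sending the standard basis vector $e_i$ to $e_{i-1}$ (indices modulo $m$).
   Context: For positive integers $n,m$, the toroidal $(n,m)$-grid is the orientable map of genus 1 with vertex set $\mathbb{Z}_n\times\mathbb{Z}_m$ and edge set $\{w_R,w_D: w\in\mathbb{Z}_n\times\mathbb{Z}_m\}$, where $(a,b)_R$ joins $(a,b)$ and $(a,b+1)$, $(a,b)_D$ joins $(a,b)$ and $(a+1,b)$ (indices modulo $n,m$; loops and parallel edges allowed), and the clockwise rotation at $(a,b)$ is $((a,b)_R,(a,b)_D,(a,b-1)_R,(a-1,b)_D)$. For an orientable map with vertex set $V$ and face set $F$: each edge gives two arcs on opposite sides, pointing in opposite directions, each lying in a face and oriented along its clockwise facial walk; $\mathcal A$ is the arc set, $v(a),f(a)$ the tail vertex and face of $a$; $N\in\{0,1\}^{\mathcal A\times V}$ with $N(a,w)=1$ iff $w=v(a)$; $M\in\{0,1\}^{\mathcal A\times F}$ with $M(a,f)=1$ iff $f=f(a)$; $D=N^TN$, $\Delta=M^TM$; $\hat N=ND^{ -1/2}$, $\hat M=M\Delta^{ -1/2}$, $Q=\hat N\hat N^T$, $P=\hat M\hat M^T$, $U=(2P-I)(2Q-I)$, and $B_t=\hat N^TU^t\hat N$. -}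

module Defs where

open import Data.Nat using (ℕ; zero; suc; _∸_; NonZero)
open import Data.Nat.DivMod using (_mod_)
open import Data.Fin as F using (Fin; toℕ)
open import Data.Fin.Properties using () renaming (_≟_ to _≟F_)
open import Data.Integer using (+_)
open import Data.Rational using (ℚ; 0ℚ; 1ℚ; _+_; _*_; _-_; _/_; _<_)
open import Data.Bool using (Bool; true; false; if_then_else_)
open import Data.List using (List; []; _∷_; allFin; foldr; map; cartesianProduct; filter; length; upTo)
open import Data.Bool.ListAction using (any)
open import Data.List.Membership.Propositional using (_∈_)
open import Data.Product using (_×_; _,_)
open import Data.Product.Properties using (≡-dec)
open import Relation.Nullary using (Dec; yes; no; ¬_; does)
open import Relation.Binary.PropositionalEquality using (_≡_; _≢_; refl)

-- Generic finite matrices with rational entries.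
-- A matrix with row index type I and column index type J is a function;
-- the index *sets* are given by explicit enumeration lists (used in sums).

Mat : Set → Set → Set
Mat I J = I → J → ℚ

Σℚ : List ℚ → ℚ
Σℚ = foldr _+_ 0ℚ

mul : {I J K : Set} → List J → Mat I J → Mat J K → Mat I K
mul js A B i k = Σℚ (map (λ j → A i j * B j k) js)

transpose : {I J : Set} → Mat I J → Mat J I
transpose A j i = A i j

add : {I J : Set} → Mat I J → Mat I J → Mat I J
add A B i j = A i j + B i j

sub : {I J : Set} → Mat I J → Mat I J → Mat I J
sub A B i j = A i j - B i j

scale : {I J : Set} → ℚ → Mat I J → Mat I J
scale c A i j = c * A i j

⟦_⟧ : {P : Set} → Dec P → ℚ
⟦ yes _ ⟧ = 1ℚ
⟦ no _ ⟧ = 0ℚ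

idMat : {I : Set} → ((x y : I) → Dec (x ≡ y)) → Mat I I
idMat eq i j = ⟦ eq i j ⟧

pow : {I : Set} → ((x y : I) → Dec (x ≡ y)) → List I → Mat I I → ℕ → Mat I I
pow eq is A zero = idMat eq
pow eq is A (suc t) = mul is (pow eq is A t) A

-- S is the (positive, diagonal) inverse square root D^{-1/2} of the
-- diagonal matrix D on the index set is: S is diagonal with positive
-- diagonal entries and S_xx^2 * D_xx = 1.
IsInvSqrt : {I : Set} → List I → Mat I I → Mat I I → Set
IsInvSqrt {I} is D S =
  ((x y : I) → x ∈ is → y ∈ is → x ≢ y → S x y ≡ 0ℚ)
  × ((x : I) → x ∈ is → (0ℚ < S x x) × (S x x * S x x * D x x ≡ 1ℚ))

sucMod : {k : ℕ} .{{_ : NonZero k}} → Fin k → Fin k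
sucMod {k} j = (suc (toℕ j)) mod k

predMod : {k : ℕ} .{{_ : NonZero k}} → Fin k → Fin k
predMod {k} j = (toℕ j Data.Nat.+ (k ∸ 1)) mod k

-- Directions of the four edge-ends at a vertex (a,b) of the toroidal grid:
--   R = (a,b)_R , D = (a,b)_D , L = (a,b-1)_R , U = (a-1,b)_D
-- so the clockwise rotation at (a,b) is (R , D , L , U).

data Dir : Set where
  R D L U : Dir

_≟Dir_ : (x y : Dir) → Dec (x ≡ y)
R ≟Dir R = yes refl
R ≟Dir D = no λ ()
R ≟Dir L = no λ ()
R ≟Dir U = no λ ()
D ≟Dir R = no λ ()
D ≟Dir D = yes refl
D ≟Dir L = no λ ()
D ≟Dir U = no λ ()
L ≟Dir R = no λ ()
L ≟Dir D = no λ ()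
L ≟Dir L = yes refl
L ≟Dir U = no λ ()
U ≟Dir R = no λ ()
U ≟Dir D = no λ ()
U ≟Dir L = no λ ()
U ≟Dir U = yes refl

dirs : List Dir
dirs = R ∷ D ∷ L ∷ U ∷ []

rot : Dir → Dir
rot R = D
rot D = L
rot L = U
rot U = R

rot⁻ : Dir → Dir
rot⁻ R = U
rot⁻ D = R
rot⁻ L = D
rot⁻ U = L

module Grid (n m : ℕ) .{{_ : NonZero n}} .{{_ : NonZero m}} where

  Vtx : Set
  Vtx = Fin n × Fin m

  _≟V_ : (x y : Vtx) → Dec (x ≡ y)
  _≟V_ = ≡-dec _≟F_ _≟F_

  vtxs : List Vtx
  vtxs = cartesianProduct (allFin n) (allFin m)

  -- An arc is a dart: the end of an edge at its tail vertex,
  -- i.e. the arc of that edge pointing away from the vertex.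
  Arc : Set
  Arc = Vtx × Dir

  _≟A_ : (x y : Arc) → Dec (x ≡ y)
  _≟A_ = ≡-dec _≟V_ _≟Dir_

  arcs : List Arc
  arcs = cartesianProduct vtxs dirs

  tail : Arc → Vtx
  tail (w , _) = w

  -- the other end of the same edge (arc on the other side, opposite direction)
  θ : Arc → Arc
  θ ((a , b) , R) = ((a , sucMod b) , L)
  θ ((a , b) , L) = ((a , predMod b) , R)
  θ ((a , b) , D) = ((sucMod a , b) , U)
  θ ((a , b) , U) = ((predMod a , b) , D)

  -- next arc along the clockwise facial walk
  φ : Arc → Arc
  φ a with θ a
  ... | (w , d) = (w , rot⁻ d)

  iter : ℕ → Arc → Arc
  iter zero a = a
  iter (suc i) a = φ (iter i a)

  sameFace : Arc → Arc → Bool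
  sameFace a b = any (λ i → does (iter i a ≟A b)) (upTo (length arcs))

  -- canonical representative of the face of a: first arc (in the
  -- enumeration) of its face.  Faces are indexed by these representatives.
  rep : Arc → Arc
  rep a with filter (λ b → sameFace a b Data.Bool.≟ true) arcs
  ... | [] = a
  ... | (b ∷ _) = b

  Face : Set
  Face = Arc

  faces : List Face
  faces = filter (λ r → rep r ≟A r) arcs

  face : Arc → Face
  face = rep

  N : Mat Arc Vtx
  N a w = ⟦ w ≟V tail a ⟧

  M : Mat Arc Face
  M a f = ⟦ f ≟A face a ⟧

  Dm : Mat Vtx Vtx
  Dm = mul arcs (transpose N) N

  Δm : Mat Face Face
  Δm = mul arcs (transpose M) M

  -- Given the inverse square roots Sv = D^{-1/2}, Sf = Δ^{-1/2}:
  module Walk (Sv : Mat Vtx Vtx) (Sf : Mat Face Face) where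

    N̂ : Mat Arc Vtx
    N̂ = mul vtxs N Sv

    M̂ : Mat Arc Face
    M̂ = mul faces M Sf

    Q : Mat Arc Arc
    Q = mul vtxs N̂ (transpose N̂)

    P : Mat Arc Arc
    P = mul faces M̂ (transpose M̂)

    I : Mat Arc Arc
    I = idMat _≟A_

    two : ℚ
    two = + 2 / 1

    Um : Mat Arc Arc
    Um = mul arcs (sub (scale two P) I) (sub (scale two Q) I)

    B : ℕ → Mat Vtx Vtx
    B t = mul arcs (transpose N̂) (mul arcs (pow _≟A_ arcs Um t) N̂)

-- The m × m cyclic permutation matrix P_m : e_i ↦ e_{i-1}, i.e.
-- (P_m)_{r c} = 1 iff r = c - 1 (mod m); and its inverse e_i ↦ e_{i+1}.

cycPerm : (m : ℕ) .{{_ : NonZero m}} → Mat (Fin m) (Fin m)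
cycPerm m r c = ⟦ r ≟F predMod c ⟧

cycPermInv : (m : ℕ) .{{_ : NonZero m}} → Mat (Fin m) (Fin m)
cycPermInv m r c = ⟦ r ≟F sucMod c ⟧

cycPow : (m : ℕ) .{{_ : NonZero m}} → ℕ → Mat (Fin m) (Fin m)
cycPow m = pow _≟F_ (allFin m) (cycPerm m)

cycPowInv : (m : ℕ) .{{_ : NonZero m}} → ℕ → Mat (Fin m) (Fin m)
cycPowInv m = pow _≟F_ (allFin m) (cycPermInv m)

{-# OPTIONS --safe #-}

-- In the one-row torus the vertex j carries the arcs (j,R), (j,D), (j,L), (j,U), and the face
-- indexed by j consists of (j,R), (j,U), (j+1,D), (j+1,L).  Thus D = Δ = 4I, and Q, P are 1/4
-- times the relations "same tail" and "same face" on arcs.  Call R, U the up-right and D, L the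
-- down-left directions: 2Q − I swaps the two halves of every vertex star, and 2P − I swaps the
-- two halves of every face.  The up-right half of face j is that of star j and its down-left
-- half is that of star j+1, so U = (2P − I)(2Q − I) moves the down-left half of star j to
-- star j+1 and the up-right half to star j−1.  The column of N̂ at j is half the sum of the two
-- halves of star j; after t steps they sit at stars j+t and j−t, and pairing with the column of
-- N̂ at i gives B_t(i,j) = ½([i = j−t] + [i = j+t]).

module Submission where

open import Defs
open import Data.Bool using (Bool; true; false; not; T)
import Data.Bool as Bool
open import Data.Bool.Properties using (T-≡)
open import Data.Empty using (⊥-elim)
open import Data.Fin using (Fin; zero; toℕ; #_)
open import Data.Fin.Properties using () renaming (_≟_ to _≟F_)
import Data.Fin.Properties as Fin
import Data.Integer as ℤ
open import Data.List using (List; []; _∷_; map; _++_; cartesianProduct; length; upTo; filter; allFin)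
open import Data.List.Properties using (filter-≐)
open import Data.List.Membership.Propositional using (_∈_; lose)
open import Data.List.Membership.Propositional.Properties
  using (∈-cartesianProduct⁺; ∈-allFin; ∈-upTo⁺; ∈-filter⁺; ∈-filter⁻)
open import Data.List.Relation.Unary.All using ([]; _∷_)
import Data.List.Relation.Unary.All as All
open import Data.List.Relation.Unary.AllPairs using ([]; _∷_)
open import Data.List.Relation.Unary.Any using (here; there; satisfied)
open import Data.List.Relation.Unary.Any.Properties using (any⁺; any⁻)
open import Data.List.Relation.Unary.Unique.Propositional using (Unique)
import Data.List.Relation.Unary.Unique.Propositional.Properties as Unique
open import Data.Nat using (ℕ; zero; suc; _∸_; _%_; NonZero)
import Data.Nat as ℕ
open import Data.Nat.DivMod using (_mod_; %-distribˡ-+; m%n%n≡m%n; [m+n]%n≡m%n; m<n⇒m%n≡m)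
open import Data.Nat.GeneralisedArithmetic using (iterate; fold)
import Data.Nat.Properties as ℕ
open import Data.Product using (_×_; _,_; proj₁; proj₂; Σ-syntax)
open import Data.Rational using (ℚ; ½; _*_; _+_; _-_; _<_; _/_; 0ℚ; 1ℚ; positive)
import Data.Rational.Properties as ℚ
open import Data.Rational.Solver using (module +-*-Solver)
open +-*-Solver using (solve; con; _:+_; _:*_; _:-_; _:=_)
open import Function.Base using (_∘_)
open import Function.Bundles using (Equivalence)
open import Relation.Binary.Definitions using (tri<; tri≈; tri>)
open import Relation.Binary.PropositionalEquality
open import Relation.Nullary using (Dec; yes; no; ¬_; does)
open import Relation.Nullary.Decidable using (toWitness; isYes≗does; dec-true)

∑ : {A : Set} → List A → (A → ℚ) → ℚ
∑ xs f = Σℚ (map f xs)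

module _ {A : Set} where

  ∑-cong : (xs : List A) {f g : A → ℚ} → (∀ x → x ∈ xs → f x ≡ g x) → ∑ xs f ≡ ∑ xs g
  ∑-cong []       f≗g = refl
  ∑-cong (x ∷ xs) f≗g = cong₂ _+_ (f≗g x (here refl)) (∑-cong xs (λ y y∈ → f≗g y (there y∈)))

  ∑-zero : (xs : List A) {f : A → ℚ} → (∀ x → x ∈ xs → f x ≡ 0ℚ) → ∑ xs f ≡ 0ℚ
  ∑-zero []       f≗0 = refl
  ∑-zero (x ∷ xs) f≗0 = cong₂ _+_ (f≗0 x (here refl)) (∑-zero xs (λ y y∈ → f≗0 y (there y∈)))

  ∑-+ : (xs : List A) (f g : A → ℚ) → ∑ xs (λ x → f x + g x) ≡ ∑ xs f + ∑ xs g
  ∑-+ []       f g = refl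
  ∑-+ (x ∷ xs) f g = trans (cong (f x + g x +_) (∑-+ xs f g)) (swap (f x) (g x) (∑ xs f) (∑ xs g))
    where
    swap : ∀ a b c d → (a + b) + (c + d) ≡ (a + c) + (b + d)
    swap = solve 4 (λ a b c d → (a :+ b) :+ (c :+ d) := (a :+ c) :+ (b :+ d)) refl

  ∑-*ˡ : (xs : List A) (c : ℚ) (f : A → ℚ) → ∑ xs (λ x → c * f x) ≡ c * ∑ xs f
  ∑-*ˡ []       c f = sym (ℚ.*-zeroʳ c)
  ∑-*ˡ (x ∷ xs) c f = trans (cong (c * f x +_) (∑-*ˡ xs c f)) (sym (ℚ.*-distribˡ-+ c (f x) (∑ xs f)))

  ∑-pick : (xs : List A) → Unique xs → (f : A → ℚ) {x : A} → x ∈ xs →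
           (∀ y → y ∈ xs → y ≢ x → f y ≡ 0ℚ) → ∑ xs f ≡ f x
  ∑-pick (y ∷ xs) (y∉xs ∷ xs!) f (here refl) f≗0 =
    trans (cong (f y +_) (∑-zero xs (λ z z∈ → f≗0 z (there z∈) (λ z≡y → y∉xs! z∈ (sym z≡y)))))
          (ℚ.+-identityʳ (f y))
    where y∉xs! = All.lookup y∉xs
  ∑-pick (y ∷ xs) (y∉xs ∷ xs!) f (there x∈) f≗0 =
    trans (cong (_+ ∑ xs f) (f≗0 y (here refl) (All.lookup y∉xs x∈)))
          (trans (ℚ.+-identityˡ (∑ xs f)) (∑-pick xs xs! f x∈ (λ z z∈ → f≗0 z (there z∈))))

  ∑-scale-sub : (xs : List A) (c : ℚ) (f g : A → ℚ) →
                ∑ xs (λ x → c * f x - g x) ≡ c * ∑ xs f - ∑ xs g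
  ∑-scale-sub []       c f g = sym (cong (_- 0ℚ) (ℚ.*-zeroʳ c))
  ∑-scale-sub (x ∷ xs) c f g =
    trans (cong (c * f x - g x +_) (∑-scale-sub xs c f g)) (regroup c (f x) (g x) (∑ xs f) (∑ xs g))
    where
    regroup : ∀ c a b s t → (c * a - b) + (c * s - t) ≡ c * (a + s) - (b + t)
    regroup = solve 5 (λ c a b s t → (c :* a :- b) :+ (c :* s :- t) := c :* (a :+ s) :- (b :+ t)) refl

∑-swap : {A B : Set} (xs : List A) (ys : List B) (f : A → B → ℚ) →
         ∑ xs (λ x → ∑ ys (f x)) ≡ ∑ ys (λ y → ∑ xs (λ x → f x y))
∑-swap []       ys f = sym (∑-zero ys (λ _ _ → refl))
∑-swap (x ∷ xs) ys f =
  trans (cong (∑ ys (f x) +_) (∑-swap xs ys f)) (sym (∑-+ ys (f x) (λ y → ∑ xs (λ x′ → f x′ y))))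

∑-++ : {A : Set} (xs ys : List A) (f : A → ℚ) → ∑ (xs ++ ys) f ≡ ∑ xs f + ∑ ys f
∑-++ []       ys f = sym (ℚ.+-identityˡ (∑ ys f))
∑-++ (x ∷ xs) ys f = trans (cong (f x +_) (∑-++ xs ys f)) (sym (ℚ.+-assoc (f x) (∑ xs f) (∑ ys f)))

∑-map : {A B : Set} (g : B → A) (ys : List B) (f : A → ℚ) → ∑ (map g ys) f ≡ ∑ ys (λ y → f (g y))
∑-map g []       f = refl
∑-map g (y ∷ ys) f = cong (f (g y) +_) (∑-map g ys f)

∑-cartesianProduct : {A B : Set} (xs : List A) (ys : List B) (f : A × B → ℚ) →
                     ∑ (cartesianProduct xs ys) f ≡ ∑ xs (λ x → ∑ ys (λ y → f (x , y)))
∑-cartesianProduct []       ys f = refl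
∑-cartesianProduct (x ∷ xs) ys f =
  trans (∑-++ (map (x ,_) ys) _ f) (cong₂ _+_ (∑-map (x ,_) ys f) (∑-cartesianProduct xs ys f))

⟦⟧-cong : {A B : Set} (a? : Dec A) (b? : Dec B) → (A → B) → (B → A) → ⟦ a? ⟧ ≡ ⟦ b? ⟧
⟦⟧-cong (yes _) (yes _) _   _   = refl
⟦⟧-cong (yes a) (no ¬b) a→b _   = ⊥-elim (¬b (a→b a))
⟦⟧-cong (no ¬a) (yes b) _   b→a = ⊥-elim (¬a (b→a b))
⟦⟧-cong (no _)  (no _)  _   _   = refl

⟦⟧-yes : {A : Set} (a? : Dec A) → A → ⟦ a? ⟧ ≡ 1ℚ
⟦⟧-yes (yes _) _ = refl
⟦⟧-yes (no ¬a) a = ⊥-elim (¬a a)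

⟦⟧-no : {A : Set} (a? : Dec A) → ¬ A → ⟦ a? ⟧ ≡ 0ℚ
⟦⟧-no (yes a) ¬a = ⊥-elim (¬a a)
⟦⟧-no (no _)  _  = refl

module _ {A : Set} (_≟_ : (x y : A) → Dec (x ≡ y)) where

  ⟦≟⟧-sym : (x y : A) → ⟦ x ≟ y ⟧ ≡ ⟦ y ≟ x ⟧
  ⟦≟⟧-sym x y = ⟦⟧-cong (x ≟ y) (y ≟ x) sym sym

  ∑-δ : (xs : List A) → Unique xs → (f : A → ℚ) {x : A} → x ∈ xs →
        ∑ xs (λ y → ⟦ y ≟ x ⟧ * f y) ≡ f x
  ∑-δ xs xs! f {x} x∈ =
    trans (∑-pick xs xs! _ x∈ (λ y _ y≢x → trans (cong (_* f y) (⟦⟧-no (y ≟ x) y≢x)) (ℚ.*-zeroˡ (f y))))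
          (trans (cong (_* f x) (⟦⟧-yes (x ≟ x) refl)) (ℚ.*-identityˡ (f x)))

act : {I J : Set} → List J → Mat I J → (J → ℚ) → I → ℚ
act js A v i = ∑ js (λ j → A i j * v j)

module _ {I J : Set} (js : List J) (A : Mat I J) where

  act-cong : {v w : J → ℚ} → (∀ j → v j ≡ w j) → ∀ i → act js A v i ≡ act js A w i
  act-cong v≗w i = ∑-cong js (λ j _ → cong (A i j *_) (v≗w j))

  act-combination : (c : ℚ) (v w : J → ℚ) → ∀ i →
                    act js A (λ j → c * (v j + w j)) i ≡ c * (act js A v i + act js A w i)
  act-combination c v w i = begin
    ∑ js (λ j → A i j * (c * (v j + w j)))     ≡⟨ ∑-cong js (λ j _ → distribute (A i j) c (v j) (w j)) ⟩
    ∑ js (λ j → c * (A i j * v j + A i j * w j)) ≡⟨ ∑-*ˡ js c _ ⟩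
    c * ∑ js (λ j → A i j * v j + A i j * w j)   ≡⟨ cong (c *_) (∑-+ js _ _) ⟩
    c * (act js A v i + act js A w i)            ∎
    where
    open ≡-Reasoning
    distribute : ∀ a c x y → a * (c * (x + y)) ≡ c * (a * x + a * y)
    distribute = solve 4 (λ a c x y → a :* (c :* (x :+ y)) := c :* (a :* x :+ a :* y)) refl

act-mul : {I J K : Set} (js : List J) (ks : List K) (A : Mat I J) (B : Mat J K) (v : K → ℚ) →
          ∀ i → act ks (mul js A B) v i ≡ act js A (act ks B v) i
act-mul js ks A B v i = begin
  ∑ ks (λ k → ∑ js (λ j → A i j * B j k) * v k)  ≡⟨ ∑-cong ks (λ k _ → pushIn k) ⟩
  ∑ ks (λ k → ∑ js (λ j → A i j * (B j k * v k))) ≡⟨ ∑-swap ks js _ ⟩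
  ∑ js (λ j → ∑ ks (λ k → A i j * (B j k * v k))) ≡⟨ ∑-cong js (λ j _ → ∑-*ˡ ks (A i j) _) ⟩
  act js A (act ks B v) i                          ∎
  where
  open ≡-Reasoning
  pushIn : ∀ k → ∑ js (λ j → A i j * B j k) * v k ≡ ∑ js (λ j → A i j * (B j k * v k))
  pushIn k = trans (ℚ.*-comm _ (v k))
    (trans (sym (∑-*ˡ js (v k) _)) (∑-cong js (λ j _ → rearrange (v k) (A i j) (B j k))))
    where
    rearrange : ∀ z x y → z * (x * y) ≡ x * (y * z)
    rearrange = solve 3 (λ z x y → z :* (x :* y) := x :* (y :* z)) refl

module _ {I : Set} (_≟_ : (x y : I) → Dec (x ≡ y)) (is : List I) (is! : Unique is) where

  act-idMat : (v : I → ℚ) {i : I} → i ∈ is → act is (idMat _≟_) v i ≡ v i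
  act-idMat v {i} i∈ =
    trans (∑-cong is (λ j _ → cong (_* v j) (⟦≟⟧-sym _≟_ i j))) (∑-δ _≟_ is is! v i∈)

  act-basis : {K : Set} (A : Mat K I) {p : I} → p ∈ is → ∀ k → act is A (λ j → ⟦ j ≟ p ⟧) k ≡ A k p
  act-basis A p∈ k = trans (∑-cong is (λ j _ → ℚ.*-comm (A k j) _)) (∑-δ _≟_ is is! (A k) p∈)

  act-scale-sub-idMat : (c : ℚ) (A : Mat I I) (v : I → ℚ) {i : I} → i ∈ is →
                   act is (sub (scale c A) (idMat _≟_)) v i ≡ c * act is A v i - v i
  act-scale-sub-idMat c A v {i} i∈ = begin
    ∑ is (λ j → (c * A i j - idMat _≟_ i j) * v j)     ≡⟨ ∑-cong is (λ j _ → distribute c (A i j) _ (v j)) ⟩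
    ∑ is (λ j → c * (A i j * v j) - idMat _≟_ i j * v j) ≡⟨ ∑-scale-sub is c _ _ ⟩
    c * act is A v i - act is (idMat _≟_) v i             ≡⟨ cong (c * act is A v i -_) (act-idMat v i∈) ⟩
    c * act is A v i - v i                                ∎
    where
    open ≡-Reasoning
    distribute : ∀ c a e x → (c * a - e) * x ≡ c * (a * x) - e * x
    distribute = solve 4 (λ c a e x → (c :* a :- e) :* x := c :* (a :* x) :- e :* x) refl

  act-pow-orbit : (A : Mat I I) {X : Set} (f : X → I → ℚ) (g : X → X) →
                  (∀ x i → act is A (f x) i ≡ f (g x) i) →
                  (∀ i → i ∈ is) → ∀ t x i → act is (pow _≟_ is A t) (f x) i ≡ f (iterate g x t) i
  act-pow-orbit A f g step complete zero    x i = act-idMat (f x) (complete i)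
  act-pow-orbit A f g step complete (suc t) x i =
    trans (act-mul is is (pow _≟_ is A t) A (f x) i)
      (trans (act-cong is (pow _≟_ is A t) (step x) i) (act-pow-orbit A f g step complete t (g x) i))

  pow-graph : (∀ i → i ∈ is) → (g : I → I) →
              ∀ t i j → pow _≟_ is (λ r c → ⟦ r ≟ g c ⟧) t i j ≡ ⟦ i ≟ iterate g j t ⟧
  pow-graph complete g t i j =
    trans (sym (act-basis (pow _≟_ is G t) (complete j) i))
          (act-pow-orbit G (λ p r → ⟦ r ≟ p ⟧) g (λ p → act-basis G (complete p)) complete t j i)
    where
    G : Mat I I
    G r c = ⟦ r ≟ g c ⟧

square-mono-< : ∀ {x y} → 0ℚ < x → x < y → x * x < y * y
square-mono-< {x} {y} 0<x x<y = ℚ.<-trans (ℚ.*-monoʳ-<-pos x x<y) (ℚ.*-monoˡ-<-pos y x<y)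
  where instance _ = positive 0<x
                 _ = positive (ℚ.<-trans 0<x x<y)

square-injective-pos : ∀ {r s} → 0ℚ < r → 0ℚ < s → r * r ≡ s * s → r ≡ s
square-injective-pos {r} {s} 0<r 0<s r²≡s² with ℚ.<-cmp r s
... | tri< r<s _ _ = ⊥-elim (ℚ.<-irrefl r²≡s² (square-mono-< 0<r r<s))
... | tri≈ _ r≡s _ = r≡s
... | tri> _ _ s<r = ⊥-elim (ℚ.<-irrefl (sym r²≡s²) (square-mono-< 0<s s<r))

four : ℚ
four = ℤ.+ 4 / 1

module _ {I : Set} (_≟_ : (x y : I) → Dec (x ≡ y)) (is : List I) {D S : Mat I I} where

  invSqrt-of-four : IsInvSqrt is D S → (∀ x → x ∈ is → D x x ≡ four) →
                    ∀ {x y} → x ∈ is → y ∈ is → S x y ≡ ½ * ⟦ x ≟ y ⟧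
  invSqrt-of-four (offDiag , diag) D≡4 {x} {y} x∈ y∈ with x ≟ y
  ... | no x≢y  = offDiag x y x∈ y∈ x≢y
  ... | yes refl = square-injective-pos (proj₁ (diag x x∈)) (ℚ.positive⁻¹ ½) S²≡¼
    where
    open ≡-Reasoning
    S²≡¼ : S x x * S x x ≡ ½ * ½
    S²≡¼ = begin
      S x x * S x x                    ≡⟨ sym (ℚ.*-identityʳ _) ⟩
      S x x * S x x * (four * (½ * ½)) ≡⟨ sym (ℚ.*-assoc (S x x * S x x) four (½ * ½)) ⟩
      S x x * S x x * four * (½ * ½)   ≡⟨ cong (λ d → S x x * S x x * d * (½ * ½)) (sym (D≡4 x x∈)) ⟩
      S x x * S x x * D x x * (½ * ½)  ≡⟨ cong (_* (½ * ½)) (proj₂ (diag x x∈)) ⟩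
      1ℚ * (½ * ½)                     ≡⟨ ℚ.*-identityˡ _ ⟩
      ½ * ½                            ∎

[m%n+o]%n≡[m+o]%n : ∀ m o n .{{_ : NonZero n}} → (m % n ℕ.+ o) % n ≡ (m ℕ.+ o) % n
[m%n+o]%n≡[m+o]%n m o n = begin
  (m % n ℕ.+ o) % n         ≡⟨ %-distribˡ-+ (m % n) o n ⟩
  (m % n % n ℕ.+ o % n) % n ≡⟨ cong (λ r → (r ℕ.+ o % n) % n) (m%n%n≡m%n m n) ⟩
  (m % n ℕ.+ o % n) % n     ≡⟨ sym (%-distribˡ-+ m o n) ⟩
  (m ℕ.+ o) % n             ∎
  where open ≡-Reasoning

module _ {m : ℕ} .{{_ : NonZero m}} where

  private
    toℕ-mod : ∀ x → toℕ (x mod m) ≡ x % m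
    toℕ-mod x = Fin.toℕ-fromℕ< _

    toℕ[j+m]%m : (j : Fin m) → (toℕ j ℕ.+ m) % m ≡ toℕ j
    toℕ[j+m]%m j = trans ([m+n]%n≡m%n (toℕ j) m) (m<n⇒m%n≡m (Fin.toℕ<n j))

    1+[m∸1]≡m : 1 ℕ.+ (m ∸ 1) ≡ m
    1+[m∸1]≡m = ℕ.m+[n∸m]≡n (ℕ.>-nonZero⁻¹ m)

  sucMod-predMod : (j : Fin m) → sucMod (predMod j) ≡ j
  sucMod-predMod j = Fin.toℕ-injective (begin
    toℕ (sucMod (predMod j))              ≡⟨ toℕ-mod _ ⟩
    suc (toℕ (predMod j)) % m             ≡⟨ cong (λ r → suc r % m) (toℕ-mod _) ⟩
    suc ((toℕ j ℕ.+ (m ∸ 1)) % m) % m     ≡⟨ cong (_% m) (ℕ.+-comm 1 _) ⟩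
    ((toℕ j ℕ.+ (m ∸ 1)) % m ℕ.+ 1) % m   ≡⟨ [m%n+o]%n≡[m+o]%n (toℕ j ℕ.+ (m ∸ 1)) 1 m ⟩
    (toℕ j ℕ.+ (m ∸ 1) ℕ.+ 1) % m         ≡⟨ cong (_% m) (ℕ.+-assoc (toℕ j) (m ∸ 1) 1) ⟩
    (toℕ j ℕ.+ ((m ∸ 1) ℕ.+ 1)) % m       ≡⟨ cong (λ r → (toℕ j ℕ.+ r) % m) (ℕ.+-comm (m ∸ 1) 1) ⟩
    (toℕ j ℕ.+ (1 ℕ.+ (m ∸ 1))) % m       ≡⟨ cong (λ r → (toℕ j ℕ.+ r) % m) 1+[m∸1]≡m ⟩
    (toℕ j ℕ.+ m) % m                     ≡⟨ toℕ[j+m]%m j ⟩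
    toℕ j                                 ∎)
    where open ≡-Reasoning

  predMod-sucMod : (j : Fin m) → predMod (sucMod j) ≡ j
  predMod-sucMod j = Fin.toℕ-injective (begin
    toℕ (predMod (sucMod j))              ≡⟨ toℕ-mod _ ⟩
    (toℕ (sucMod j) ℕ.+ (m ∸ 1)) % m      ≡⟨ cong (λ r → (r ℕ.+ (m ∸ 1)) % m) (toℕ-mod _) ⟩
    (suc (toℕ j) % m ℕ.+ (m ∸ 1)) % m     ≡⟨ [m%n+o]%n≡[m+o]%n (suc (toℕ j)) (m ∸ 1) m ⟩
    suc (toℕ j ℕ.+ (m ∸ 1)) % m           ≡⟨ cong (_% m) (sym (ℕ.+-suc (toℕ j) (m ∸ 1))) ⟩
    (toℕ j ℕ.+ (1 ℕ.+ (m ∸ 1))) % m       ≡⟨ cong (λ r → (toℕ j ℕ.+ r) % m) 1+[m∸1]≡m ⟩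
    (toℕ j ℕ.+ m) % m                     ≡⟨ toℕ[j+m]%m j ⟩
    toℕ j                                 ∎)
    where open ≡-Reasoning

  ⟦≟predMod⟧ : (k j : Fin m) → ⟦ k ≟F predMod j ⟧ ≡ ⟦ sucMod k ≟F j ⟧
  ⟦≟predMod⟧ k j = ⟦⟧-cong (k ≟F predMod j) (sucMod k ≟F j)
    (λ k≡ → trans (cong sucMod k≡) (sucMod-predMod j))
    (λ suc≡ → trans (sym (predMod-sucMod k)) (cong predMod suc≡))

module _ {A K : Set} (_≟_ : (x y : K) → Dec (x ≡ y)) (κ : A → K) where

  -- The matrices N and M of the map are incidence _≟V_ tail and incidence _≟A_ face.
  incidence : Mat A K
  incidence a k = ⟦ k ≟ κ a ⟧

  module _ (ks : List K) (ks! : Unique ks) (κ∈ks : ∀ a → κ a ∈ ks)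
           {S : Mat K K} (S≡½I : ∀ {x y} → x ∈ ks → y ∈ ks → S x y ≡ ½ * ⟦ x ≟ y ⟧) where

    incidence-halved : ∀ a {k} → k ∈ ks → mul ks incidence S a k ≡ ½ * ⟦ k ≟ κ a ⟧
    incidence-halved a k∈ =
      trans (∑-δ _≟_ ks ks! (λ x → S x _) (κ∈ks a))
            (trans (S≡½I (κ∈ks a) k∈) (cong (½ *_) (⟦≟⟧-sym _≟_ (κ a) _)))

    incidence-halved-gram : ∀ a b → mul ks (mul ks incidence S) (transpose (mul ks incidence S)) a b
                                    ≡ ½ * ½ * ⟦ κ a ≟ κ b ⟧
    incidence-halved-gram a b =
      trans (∑-cong ks (λ k k∈ → trans (cong₂ _*_ (incidence-halved a k∈) (incidence-halved b k∈))
                                       (regroup ½ ⟦ k ≟ κ a ⟧ ⟦ k ≟ κ b ⟧)))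
            (∑-δ _≟_ ks ks! (λ k → ½ * ½ * ⟦ k ≟ κ b ⟧) (κ∈ks a))
      where
      regroup : ∀ h x y → h * x * (h * y) ≡ x * (h * h * y)
      regroup = solve 3 (λ h x y → h :* x :* (h :* y) := x :* (h :* h :* y)) refl

two : ℚ
two = ℤ.+ 2 / 1

upRight : Dir → Bool
upRight R = true
upRight D = false
upRight L = false
upRight U = true

side : Bool → Dir → ℚ
side h d = ⟦ h Bool.≟ upRight d ⟧

side-total : ∀ d → side false d + side true d ≡ 1ℚ
side-total d with upRight d
... | false = refl
... | true  = refl

side-complement : ∀ h d → 1ℚ - side h d ≡ side (not h) d
side-complement h d with h | upRight d
... | false | false = refl
... | false | true  = refl
... | true  | false = refl
... | true  | true  = refl

∑-side : ∀ h → ∑ dirs (side h) ≡ two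
∑-side false = refl
∑-side true  = refl

module ArcFibers (n m : ℕ) .{{_ : NonZero n}} .{{_ : NonZero m}} where
  open Grid n m

  dir : Arc → Dir
  dir = proj₂

  vtxs-unique : Unique vtxs
  vtxs-unique = Unique.cartesianProduct⁺ (Unique.allFin⁺ n) (Unique.allFin⁺ m)

  arcs-unique : Unique arcs
  arcs-unique = Unique.cartesianProduct⁺ vtxs-unique dirs-unique
    where
    dirs-unique : Unique dirs
    dirs-unique = ((λ ()) ∷ (λ ()) ∷ (λ ()) ∷ [])
                ∷ ((λ ()) ∷ (λ ()) ∷ [])
                ∷ ((λ ()) ∷ [])
                ∷ []
                ∷ []

  ∈-vtxs : ∀ w → w ∈ vtxs
  ∈-vtxs (i , j) = ∈-cartesianProduct⁺ (∈-allFin i) (∈-allFin j)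

  ∈-arcs : ∀ a → a ∈ arcs
  ∈-arcs (w , d) = ∈-cartesianProduct⁺ (∈-vtxs w) (∈-dirs d)
    where
    ∈-dirs : ∀ d → d ∈ dirs
    ∈-dirs R = here refl
    ∈-dirs D = there (here refl)
    ∈-dirs L = there (there (here refl))
    ∈-dirs U = there (there (there (here refl)))

  -- Every fiber of κ contains exactly one arc of each direction.
  record SliceInverse {K : Set} (κ : Arc → K) : Set where
    field
      section   : K → Dir → Vtx
      κ-section : ∀ k d → κ (section k d , d) ≡ k
      section-κ : ∀ w d → section (κ (w , d)) d ≡ w

  module _ {K : Set} (_≟_ : (x y : K) → Dec (x ≡ y)) {κ : Arc → K} (slices : SliceInverse κ) where
    open SliceInverse slices

    fiber-sum : ∀ k (v : Arc → ℚ) →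
                ∑ arcs (λ a → ⟦ k ≟ κ a ⟧ * v a) ≡ ∑ dirs (λ d → v (section k d , d))
    fiber-sum k v =
      trans (∑-cartesianProduct vtxs dirs _)
        (trans (∑-swap vtxs dirs (λ w d → ⟦ k ≟ κ (w , d) ⟧ * v (w , d)))
          (∑-cong dirs (λ d _ → slice d)))
      where
      slice : ∀ d → ∑ vtxs (λ w → ⟦ k ≟ κ (w , d) ⟧ * v (w , d)) ≡ v (section k d , d)
      slice d =
        trans (∑-pick vtxs vtxs-unique _ (∈-vtxs (section k d)) off-slice)
              (trans (cong (_* v (section k d , d)) (⟦⟧-yes (k ≟ _) (sym (κ-section k d))))
                     (ℚ.*-identityˡ _))
        where
        off-slice : ∀ w → w ∈ vtxs → w ≢ section k d → ⟦ k ≟ κ (w , d) ⟧ * v (w , d) ≡ 0ℚ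
        off-slice w _ w≢ = trans (cong (_* v (w , d)) (⟦⟧-no (k ≟ _) k≢)) (ℚ.*-zeroˡ (v (w , d)))
          where
          k≢ : k ≢ κ (w , d)
          k≢ k≡ = w≢ (trans (sym (section-κ w d)) (cong (λ k′ → section k′ d) (sym k≡)))

    fiber-size : ∀ k → ∑ arcs (λ a → ⟦ k ≟ κ a ⟧ * ⟦ k ≟ κ a ⟧) ≡ four
    fiber-size k = trans (fiber-sum k (λ a → ⟦ k ≟ κ a ⟧))
                         (∑-cong dirs (λ d _ → ⟦⟧-yes (k ≟ _) (sym (κ-section k d))))

    halfFiber : K → Bool → Arc → ℚ
    halfFiber k h a = ⟦ k ≟ κ a ⟧ * side h (dir a)

    halfFiber-partition : ∀ k a → halfFiber k false a + halfFiber k true a ≡ ⟦ k ≟ κ a ⟧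
    halfFiber-partition k a =
      trans (sym (ℚ.*-distribˡ-+ ⟦ k ≟ κ a ⟧ _ _))
            (trans (cong (⟦ k ≟ κ a ⟧ *_) (side-total (dir a))) (ℚ.*-identityʳ _))

    ∑-halfFiber : ∀ k h k′ → ∑ dirs (λ d → halfFiber k h (section k′ d , d)) ≡ ⟦ k ≟ k′ ⟧ * two
    ∑-halfFiber k h k′ =
      trans (∑-cong dirs (λ d _ → cong (λ x → ⟦ k ≟ x ⟧ * side h d) (κ-section k′ d)))
            (trans (∑-*ˡ dirs ⟦ k ≟ k′ ⟧ (side h)) (cong (⟦ k ≟ k′ ⟧ *_) (∑-side h)))

    halfFiber-reflection : (Q : Mat Arc Arc) → (∀ a b → Q a b ≡ ½ * ½ * ⟦ κ a ≟ κ b ⟧) → ∀ k h a →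
                           act arcs (sub (scale two Q) (idMat _≟A_)) (halfFiber k h) a ≡ halfFiber k (not h) a
    halfFiber-reflection Q Q≡ k h a = begin
      act arcs (sub (scale two Q) (idMat _≟A_)) (halfFiber k h) a
        ≡⟨ act-scale-sub-idMat _≟A_ arcs arcs-unique two Q _ (∈-arcs a) ⟩
      two * act arcs Q (halfFiber k h) a - halfFiber k h a
        ≡⟨ cong (λ s → two * s - halfFiber k h a) averaged ⟩
      two * (½ * ½ * (⟦ k ≟ κ a ⟧ * two)) - ⟦ k ≟ κ a ⟧ * side h (dir a)
        ≡⟨ simplify ⟦ k ≟ κ a ⟧ (side h (dir a)) ⟩
      ⟦ k ≟ κ a ⟧ * (1ℚ - side h (dir a))
        ≡⟨ cong (⟦ k ≟ κ a ⟧ *_) (side-complement h (dir a)) ⟩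
      halfFiber k (not h) a ∎
      where
      open ≡-Reasoning
      averaged : act arcs Q (halfFiber k h) a ≡ ½ * ½ * (⟦ k ≟ κ a ⟧ * two)
      averaged =
        trans (∑-cong arcs (λ b _ → trans (cong (_* halfFiber k h b) (Q≡ a b))
                                          (ℚ.*-assoc (½ * ½) ⟦ κ a ≟ κ b ⟧ (halfFiber k h b))))
          (trans (∑-*ˡ arcs (½ * ½) _)
            (cong (½ * ½ *_) (trans (fiber-sum (κ a) (halfFiber k h)) (∑-halfFiber k h (κ a)))))
      simplify : ∀ c x → two * (½ * ½ * (c * two)) - c * x ≡ c * (1ℚ - x)
      simplify = solve 2 (λ c x → con two :* (con ½ :* con ½ :* (c :* con two)) :- c :* x
                                  := c :* (con 1ℚ :- x)) refl

  tail-slices : SliceInverse tail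
  tail-slices = record { section = λ w _ → w ; κ-section = λ _ _ → refl ; section-κ = λ _ _ → refl }

  Dm-diagonal : ∀ w → Dm w w ≡ four
  Dm-diagonal = fiber-size _≟V_ tail-slices

rot-orbit : ∀ d e → Σ[ i ∈ Fin 4 ] fold d rot (toℕ i) ≡ e
rot-orbit R R = # 0 , refl
rot-orbit R D = # 1 , refl
rot-orbit R L = # 2 , refl
rot-orbit R U = # 3 , refl
rot-orbit D D = # 0 , refl
rot-orbit D L = # 1 , refl
rot-orbit D U = # 2 , refl
rot-orbit D R = # 3 , refl
rot-orbit L L = # 0 , refl
rot-orbit L U = # 1 , refl
rot-orbit L R = # 2 , refl
rot-orbit L D = # 3 , refl
rot-orbit U U = # 0 , refl
rot-orbit U R = # 1 , refl
rot-orbit U D = # 2 , refl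
rot-orbit U L = # 3 , refl

4≤∣arcs∣ : ∀ m .{{_ : NonZero m}} → 4 ℕ.≤ length (Grid.arcs 1 m)
4≤∣arcs∣ (suc _) = ℕ.s≤s (ℕ.s≤s (ℕ.s≤s (ℕ.s≤s ℕ.z≤n)))

module OneRow (m : ℕ) .{{_ : NonZero m}} where
  open Grid 1 m
  open ArcFibers 1 m

  col : Arc → Fin m
  col ((_ , j) , _) = j

  -- The face containing an arc is indexed by key: face k is (k,R), (k,U), (k+1,D), (k+1,L).
  key : Arc → Fin m
  key ((_ , j) , R) = j
  key ((_ , j) , D) = predMod j
  key ((_ , j) , L) = predMod j
  key ((_ , j) , U) = j

  col-slices : SliceInverse col
  col-slices = record
    { section   = λ j _ → (zero , j)
    ; κ-section = λ _ _ → refl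
    ; section-κ = λ { (zero , _) _ → refl }
    }

  key-section : Fin m → Dir → Vtx
  key-section k R = (zero , k)
  key-section k D = (zero , sucMod k)
  key-section k L = (zero , sucMod k)
  key-section k U = (zero , k)

  key-slices : SliceInverse key
  key-slices = record { section = key-section ; κ-section = key-key-section ; section-κ = key-section-key }
    where
    key-key-section : ∀ k d → key (key-section k d , d) ≡ k
    key-key-section k R = refl
    key-key-section k D = predMod-sucMod k
    key-key-section k L = predMod-sucMod k
    key-key-section k U = refl

    key-section-key : ∀ w d → key-section (key (w , d)) d ≡ w
    key-section-key (zero , j) R = refl
    key-section-key (zero , j) D = cong (zero ,_) (sucMod-predMod j)
    key-section-key (zero , j) L = cong (zero ,_) (sucMod-predMod j)
    key-section-key (zero , j) U = refl

  ⟦≟V⟧-col : ∀ v w → ⟦ v ≟V w ⟧ ≡ ⟦ proj₂ v ≟F proj₂ w ⟧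
  ⟦≟V⟧-col (zero , i) (zero , j) =
    ⟦⟧-cong ((zero , i) ≟V (zero , j)) (i ≟F j) (cong proj₂) (cong (zero ,_))

  φ-key : ∀ a → key (φ a) ≡ key a
  φ-key ((zero , j) , R) = predMod-sucMod j
  φ-key ((zero , j) , D) = refl
  φ-key ((zero , j) , L) = refl
  φ-key ((zero , j) , U) = refl

  φ-key-section : ∀ k d → φ (key-section k d , d) ≡ (key-section k (rot d) , rot d)
  φ-key-section k R = refl
  φ-key-section k D = refl
  φ-key-section k L = cong (λ j → ((zero , j) , U)) (predMod-sucMod k)
  φ-key-section k U = refl

  iter-key : ∀ i a → key (iter i a) ≡ key a
  iter-key zero    a = refl
  iter-key (suc i) a = trans (φ-key (iter i a)) (iter-key i a)

  iter-key-section : ∀ i k d → iter i (key-section k d , d) ≡ (key-section k (fold d rot i) , fold d rot i)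
  iter-key-section zero    k d = refl
  iter-key-section (suc i) k d = trans (cong φ (iter-key-section i k d)) (φ-key-section k (fold d rot i))

  key-orbit : ∀ a b → key a ≡ key b → Σ[ i ∈ Fin 4 ] iter (toℕ i) a ≡ b
  key-orbit (w , d) (w′ , e) key≡ with rot-orbit d e
  ... | i , rotⁱd≡e = i , (begin
    iter (toℕ i) (w , d)
      ≡⟨ cong (λ x → iter (toℕ i) (x , d)) (sym (section-κ w d)) ⟩
    iter (toℕ i) (key-section (key (w , d)) d , d)
      ≡⟨ iter-key-section (toℕ i) (key (w , d)) d ⟩
    (key-section (key (w , d)) (fold d rot (toℕ i)) , fold d rot (toℕ i))
      ≡⟨ cong₂ (λ k e′ → (key-section k e′ , e′)) key≡ rotⁱd≡e ⟩
    (key-section (key (w′ , e)) e , e)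
      ≡⟨ cong (_, e) (section-κ w′ e) ⟩
    (w′ , e) ∎)
    where
    open ≡-Reasoning
    open SliceInverse key-slices

  sameFace⇒key : ∀ a b → sameFace a b ≡ true → key a ≡ key b
  sameFace⇒key a b same with satisfied (any⁻ _ (upTo (length arcs)) (Equivalence.from T-≡ same))
  ... | i , iterᵢa≡b = trans (sym (iter-key i a)) (cong key (toWitness iterᵢa≡b′))
    where iterᵢa≡b′ = subst T (sym (isYes≗does (iter i a ≟A b))) iterᵢa≡b

  key⇒sameFace : ∀ a b → key a ≡ key b → sameFace a b ≡ true
  key⇒sameFace a b key≡ with key-orbit a b key≡
  ... | i , iterᵢa≡b = Equivalence.to T-≡ (any⁺ _ (lose i∈ (Equivalence.from T-≡ hit)))
    where
    hit : does (iter (toℕ i) a ≟A b) ≡ true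
    hit = dec-true (iter (toℕ i) a ≟A b) iterᵢa≡b

    i∈ : toℕ i ∈ upTo (length arcs)
    i∈ = ∈-upTo⁺ (ℕ.<-≤-trans (Fin.toℕ<n i) (4≤∣arcs∣ m))

  private
    sameFace? : ∀ a b → Dec (sameFace a b ≡ true)
    sameFace? a b = sameFace a b Bool.≟ true

    ∈-own-face : ∀ a → a ∈ filter (sameFace? a) arcs
    ∈-own-face a = ∈-filter⁺ (sameFace? a) (∈-arcs a) (key⇒sameFace a a refl)

    same-faces : ∀ {a b} → key a ≡ key b → filter (sameFace? a) arcs ≡ filter (sameFace? b) arcs
    same-faces {a} {b} key≡ = filter-≐ (sameFace? a) (sameFace? b)
      ( (λ {c} same → key⇒sameFace b c (trans (sym key≡) (sameFace⇒key a c same)))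
      , (λ {c} same → key⇒sameFace a c (trans key≡ (sameFace⇒key b c same))) ) arcs

  key-rep : ∀ a → key (rep a) ≡ key a
  key-rep a with filter (sameFace? a) arcs in eq
  ... | []    with () ← subst (a ∈_) eq (∈-own-face a)
  ... | b ∷ _ = sym (sameFace⇒key a b (proj₂ (∈-filter⁻ (sameFace? a) {xs = arcs} b∈)))
    where b∈ = subst (b ∈_) (sym eq) (here refl)

  rep-cong : ∀ {a b} → key a ≡ key b → rep a ≡ rep b
  rep-cong {a} {b} key≡ with filter (sameFace? a) arcs in eqa | filter (sameFace? b) arcs in eqb
  ... | []    | _      with () ← subst (a ∈_) eqa (∈-own-face a)
  ... | _     | []     with () ← subst (b ∈_) eqb (∈-own-face b)
  ... | c ∷ _ | c′ ∷ _ = cong (λ { [] → c ; (x ∷ _) → x }) (trans (sym eqa) (trans (same-faces key≡) eqb))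

  face≡⇒key≡ : ∀ {a b} → face a ≡ face b → key a ≡ key b
  face≡⇒key≡ {a} {b} face≡ = trans (sym (key-rep a)) (trans (cong key face≡) (key-rep b))

  ⟦face≟face⟧ : ∀ a b → ⟦ face a ≟A face b ⟧ ≡ ⟦ key a ≟F key b ⟧
  ⟦face≟face⟧ a b = ⟦⟧-cong (face a ≟A face b) (key a ≟F key b) face≡⇒key≡ rep-cong

  faces-unique : Unique faces
  faces-unique = Unique.filter⁺ (λ r → rep r ≟A r) arcs-unique

  face∈faces : ∀ a → face a ∈ faces
  face∈faces a = ∈-filter⁺ (λ r → rep r ≟A r) (∈-arcs (rep a)) (rep-cong (key-rep a))

  face-of-face : ∀ {f} → f ∈ faces → face f ≡ f
  face-of-face f∈ = proj₂ (∈-filter⁻ (λ r → rep r ≟A r) {xs = arcs} f∈)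

  ⟦≟face⟧ : ∀ {f} → f ∈ faces → ∀ a → ⟦ f ≟A face a ⟧ ≡ ⟦ key f ≟F key a ⟧
  ⟦≟face⟧ {f} f∈ a =
    trans (cong (λ g → ⟦ g ≟A face a ⟧) (sym (face-of-face f∈))) (⟦face≟face⟧ f a)

  Δm-diagonal : ∀ f → f ∈ faces → Δm f f ≡ four
  Δm-diagonal f f∈ =
    trans (∑-cong arcs (λ a _ → cong₂ _*_ (⟦≟face⟧ f∈ a) (⟦≟face⟧ f∈ a)))
          (fiber-size _≟F_ key-slices (key f))

  vertexHalf faceHalf : Fin m → Bool → Arc → ℚ
  vertexHalf = halfFiber _≟F_ col-slices
  faceHalf   = halfFiber _≟F_ key-slices

  private
    *-zeroʳ-both : ∀ x y → x * 0ℚ ≡ y * 0ℚ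
    *-zeroʳ-both x y = trans (ℚ.*-zeroʳ x) (sym (ℚ.*-zeroʳ y))

  faceHalf-upRight : ∀ k a → faceHalf k true a ≡ vertexHalf k true a
  faceHalf-upRight k ((zero , j) , R) = refl
  faceHalf-upRight k ((zero , j) , D) = *-zeroʳ-both ⟦ k ≟F predMod j ⟧ ⟦ k ≟F j ⟧
  faceHalf-upRight k ((zero , j) , L) = *-zeroʳ-both ⟦ k ≟F predMod j ⟧ ⟦ k ≟F j ⟧
  faceHalf-upRight k ((zero , j) , U) = refl

  faceHalf-downLeft : ∀ k a → faceHalf k false a ≡ vertexHalf (sucMod k) false a
  faceHalf-downLeft k ((zero , j) , R) = *-zeroʳ-both ⟦ k ≟F j ⟧ ⟦ sucMod k ≟F j ⟧
  faceHalf-downLeft k ((zero , j) , D) = cong (_* 1ℚ) (⟦≟predMod⟧ k j)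
  faceHalf-downLeft k ((zero , j) , L) = cong (_* 1ℚ) (⟦≟predMod⟧ k j)
  faceHalf-downLeft k ((zero , j) , U) = *-zeroʳ-both ⟦ k ≟F j ⟧ ⟦ sucMod k ≟F j ⟧

  module _ (Sv : Mat Vtx Vtx) (Sf : Mat Face Face)
           (Sv-inv : IsInvSqrt vtxs Dm Sv) (Sf-inv : IsInvSqrt faces Δm Sf) where
    open Walk Sv Sf using (N̂; Q; P; I; Um; B)

    private
      Sv≡½I : ∀ {x y} → x ∈ vtxs → y ∈ vtxs → Sv x y ≡ ½ * ⟦ x ≟V y ⟧
      Sv≡½I = invSqrt-of-four _≟V_ vtxs {Dm} {Sv} Sv-inv (λ w _ → Dm-diagonal w)

      Sf≡½I : ∀ {x y} → x ∈ faces → y ∈ faces → Sf x y ≡ ½ * ⟦ x ≟A y ⟧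
      Sf≡½I = invSqrt-of-four _≟A_ faces {Δm} {Sf} Sf-inv Δm-diagonal

    N̂-column : ∀ j a → N̂ a (zero , j) ≡ ½ * ⟦ j ≟F col a ⟧
    N̂-column j a = trans (incidence-halved _≟V_ tail vtxs vtxs-unique (∈-vtxs ∘ tail) Sv≡½I a (∈-vtxs _))
                         (cong (½ *_) (⟦≟V⟧-col (zero , j) (tail a)))

    Q-col : ∀ a b → Q a b ≡ ½ * ½ * ⟦ col a ≟F col b ⟧
    Q-col a b = trans (incidence-halved-gram _≟V_ tail vtxs vtxs-unique (∈-vtxs ∘ tail) Sv≡½I a b)
                      (cong (½ * ½ *_) (⟦≟V⟧-col (tail a) (tail b)))

    P-key : ∀ a b → P a b ≡ ½ * ½ * ⟦ key a ≟F key b ⟧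
    P-key a b = trans (incidence-halved-gram _≟A_ face faces faces-unique face∈faces Sf≡½I a b)
                      (cong (½ * ½ *_) (⟦face≟face⟧ a b))

    reflectionQ reflectionP : Mat Arc Arc
    reflectionQ = sub (scale two Q) I
    reflectionP = sub (scale two P) I

    reflectionQ-swaps : ∀ k h a → act arcs reflectionQ (vertexHalf k h) a ≡ vertexHalf k (not h) a
    reflectionQ-swaps = halfFiber-reflection _≟F_ col-slices Q Q-col

    reflectionP-swaps : ∀ k h a → act arcs reflectionP (faceHalf k h) a ≡ faceHalf k (not h) a
    reflectionP-swaps = halfFiber-reflection _≟F_ key-slices P P-key

    Um-downLeft : ∀ p a → act arcs Um (vertexHalf p false) a ≡ vertexHalf (sucMod p) false a
    Um-downLeft p a = begin
      act arcs Um (vertexHalf p false) a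
        ≡⟨ act-mul arcs arcs reflectionP reflectionQ (vertexHalf p false) a ⟩
      act arcs reflectionP (act arcs reflectionQ (vertexHalf p false)) a
        ≡⟨ act-cong arcs reflectionP (reflectionQ-swaps p false) a ⟩
      act arcs reflectionP (vertexHalf p true) a
        ≡⟨ act-cong arcs reflectionP (λ b → sym (faceHalf-upRight p b)) a ⟩
      act arcs reflectionP (faceHalf p true) a
        ≡⟨ reflectionP-swaps p true a ⟩
      faceHalf p false a
        ≡⟨ faceHalf-downLeft p a ⟩
      vertexHalf (sucMod p) false a ∎
      where open ≡-Reasoning

    Um-upRight : ∀ p a → act arcs Um (vertexHalf p true) a ≡ vertexHalf (predMod p) true a
    Um-upRight p a = begin
      act arcs Um (vertexHalf p true) a
        ≡⟨ act-mul arcs arcs reflectionP reflectionQ (vertexHalf p true) a ⟩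
      act arcs reflectionP (act arcs reflectionQ (vertexHalf p true)) a
        ≡⟨ act-cong arcs reflectionP (reflectionQ-swaps p true) a ⟩
      act arcs reflectionP (vertexHalf p false) a
        ≡⟨ act-cong arcs reflectionP downLeft a ⟩
      act arcs reflectionP (faceHalf (predMod p) false) a
        ≡⟨ reflectionP-swaps (predMod p) false a ⟩
      faceHalf (predMod p) true a
        ≡⟨ faceHalf-upRight (predMod p) a ⟩
      vertexHalf (predMod p) true a ∎
      where
      open ≡-Reasoning
      downLeft : ∀ b → vertexHalf p false b ≡ faceHalf (predMod p) false b
      downLeft b = sym (trans (faceHalf-downLeft (predMod p) b)
                              (cong (λ k → vertexHalf k false b) (sucMod-predMod p)))

    private
      Umᵗ : ℕ → Mat Arc Arc
      Umᵗ = pow _≟A_ arcs Um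

    Umᵗ-downLeft : ∀ t p a →
                   act arcs (Umᵗ t) (vertexHalf p false) a ≡ vertexHalf (iterate sucMod p t) false a
    Umᵗ-downLeft = act-pow-orbit _≟A_ arcs arcs-unique Um (λ p → vertexHalf p false) sucMod Um-downLeft ∈-arcs

    Umᵗ-upRight : ∀ t p a →
                  act arcs (Umᵗ t) (vertexHalf p true) a ≡ vertexHalf (iterate predMod p t) true a
    Umᵗ-upRight = act-pow-orbit _≟A_ arcs arcs-unique Um (λ p → vertexHalf p true) predMod Um-upRight ∈-arcs

    N̂-column-halves : ∀ j b → N̂ b (zero , j) ≡ ½ * (vertexHalf j false b + vertexHalf j true b)
    N̂-column-halves j b = trans (N̂-column j b) (cong (½ *_) (sym (halfFiber-partition _≟F_ col-slices j b)))

    Umᵗ-N̂-column : ∀ t j a → act arcs (Umᵗ t) (λ b → N̂ b (zero , j)) a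
                            ≡ ½ * (vertexHalf (iterate sucMod j t) false a + vertexHalf (iterate predMod j t) true a)
    Umᵗ-N̂-column t j a = begin
      act arcs (Umᵗ t) (λ b → N̂ b (zero , j)) a
        ≡⟨ act-cong arcs (Umᵗ t) (N̂-column-halves j) a ⟩
      act arcs (Umᵗ t) (λ b → ½ * (vertexHalf j false b + vertexHalf j true b)) a
        ≡⟨ act-combination arcs (Umᵗ t) ½ _ _ a ⟩
      ½ * (act arcs (Umᵗ t) (vertexHalf j false) a + act arcs (Umᵗ t) (vertexHalf j true) a)
        ≡⟨ cong₂ (λ x y → ½ * (x + y)) (Umᵗ-downLeft t j a) (Umᵗ-upRight t j a) ⟩
      ½ * (vertexHalf (iterate sucMod j t) false a + vertexHalf (iterate predMod j t) true a) ∎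
      where open ≡-Reasoning

    B-formula : ∀ t i j → B t (zero , i) (zero , j)
                          ≡ ½ * (⟦ i ≟F iterate predMod j t ⟧ + ⟦ i ≟F iterate sucMod j t ⟧)
    B-formula t i j = begin
      B t (zero , i) (zero , j)
        ≡⟨ ∑-cong arcs (λ a _ → cong₂ _*_ (N̂-column i a) (Umᵗ-N̂-column t j a)) ⟩
      ∑ arcs (λ a → ½ * ⟦ i ≟F col a ⟧ * (½ * halves a))
        ≡⟨ ∑-cong arcs (λ a _ → regroup ½ ⟦ i ≟F col a ⟧ (halves a)) ⟩
      ∑ arcs (λ a → ⟦ i ≟F col a ⟧ * (½ * ½ * halves a))
        ≡⟨ fiber-sum _≟F_ col-slices i _ ⟩
      ∑ dirs (λ d → ½ * ½ * halves (atColumn d))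
        ≡⟨ ∑-*ˡ dirs (½ * ½) (halves ∘ atColumn) ⟩
      ½ * ½ * ∑ dirs (halves ∘ atColumn)
        ≡⟨ cong (½ * ½ *_) (∑-+ dirs (vertexHalf j⁺ false ∘ atColumn) (vertexHalf j⁻ true ∘ atColumn)) ⟩
      ½ * ½ * (∑ dirs (vertexHalf j⁺ false ∘ atColumn) + ∑ dirs (vertexHalf j⁻ true ∘ atColumn))
        ≡⟨ cong₂ (λ x y → ½ * ½ * (x + y)) (∑-halfFiber _≟F_ col-slices j⁺ false i)
                                            (∑-halfFiber _≟F_ col-slices j⁻ true i) ⟩
      ½ * ½ * (⟦ j⁺ ≟F i ⟧ * two + ⟦ j⁻ ≟F i ⟧ * two)
        ≡⟨ average ⟦ j⁺ ≟F i ⟧ ⟦ j⁻ ≟F i ⟧ ⟩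
      ½ * (⟦ j⁻ ≟F i ⟧ + ⟦ j⁺ ≟F i ⟧)
        ≡⟨ cong₂ (λ x y → ½ * (x + y)) (⟦≟⟧-sym _≟F_ j⁻ i) (⟦≟⟧-sym _≟F_ j⁺ i) ⟩
      ½ * (⟦ i ≟F j⁻ ⟧ + ⟦ i ≟F j⁺ ⟧) ∎
      where
      open ≡-Reasoning
      j⁺ j⁻ : Fin m
      j⁺ = iterate sucMod j t
      j⁻ = iterate predMod j t

      atColumn : Dir → Arc
      atColumn d = ((zero , i) , d)

      halves : Arc → ℚ
      halves a = vertexHalf j⁺ false a + vertexHalf j⁻ true a

      regroup : ∀ h x y → h * x * (h * y) ≡ x * (h * h * y)
      regroup = solve 3 (λ h x y → h :* x :* (h :* y) := x :* (h :* h :* y)) refl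

      average : ∀ x y → ½ * ½ * (x * two + y * two) ≡ ½ * (y + x)
      average = solve 2 (λ x y → con ½ :* con ½ :* (x :* con two :+ y :* con two) := con ½ :* (y :+ x)) refl

lemma7p3 : (m : ℕ) .{{_ : NonZero m}}
    → (Sv : Mat (Grid.Vtx 1 m) (Grid.Vtx 1 m)) (Sf : Mat (Grid.Face 1 m) (Grid.Face 1 m))
    → IsInvSqrt (Grid.vtxs 1 m) (Grid.Dm 1 m) Sv
    → IsInvSqrt (Grid.faces 1 m) (Grid.Δm 1 m) Sf
    → (t : ℕ) (i j : Fin m)
    → Grid.Walk.B 1 m Sv Sf t (zero , i) (zero , j) ≡ ½ * (cycPow m t i j + cycPowInv m t i j)
lemma7p3 m Sv Sf Sv-inv Sf-inv t i j =
  trans (OneRow.B-formula m Sv Sf Sv-inv Sf-inv t i j)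
        (sym (cong₂ (λ x y → ½ * (x + y)) (cycPow-graph predMod) (cycPow-graph sucMod)))
  where
  cycPow-graph : (g : Fin m → Fin m) →
                 pow _≟F_ (allFin m) (λ r c → ⟦ r ≟F g c ⟧) t i j ≡ ⟦ i ≟F iterate g j t ⟧
  cycPow-graph g = pow-graph _≟F_ (allFin m) (Unique.allFin⁺ m) ∈-allFin g t i j
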